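{- Let $p \geq 5$ be a prime number. For all odd integers $\alpha', \beta'$ and every integer $\gamma$, the sequence $q(n) = \frac{\alpha'}{2} n^2 + \frac{\beta'}{2} n + \gamma$ ($n \geq 0$) has some integer $n \geq 1$ with $D_q(n) \neq p^{\lceil \log_p n \rceil}$.
   Context: For an integer sequence $s = (s(i))_{i \geq 0}$ and an integer $n \geq 1$, the discriminator $D_s(n)$ is the least positive integer $m$ such that $s(0), \ldots, s(n-1)$ are pairwise incongruent modulo $m$. If two of $s(0), \ldots, s(n-1)$ are equal, no such $m$ exists, and then $D_s(n) \neq p^{\lceil \log_p n \rceil}$ is understood to hold. -}

module Defs where

open import Data.Nat as ℕ using (ℕ; suc; _^_; _<_; _≤_)
open import Data.Integer as ℤ using (ℤ; +_; _-_)
open import Data.Integer.DivMod using (_/ℕ_)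
open import Data.Integer.Divisibility using (_∣_)
open import Data.Product using (_×_)
open import Relation.Binary.PropositionalEquality using (_≢_)
open import Relation.Nullary using (¬_)

-- the quadratic sequence q(n) = α'/2 n² + β'/2 n + γ, computed as
-- (α' n² + β' n) / 2 + γ ; for odd α', β' the numerator n(α' n + β') is even,
-- so the division by 2 is exact.
quadSeq : ℤ → ℤ → ℤ → ℕ → ℤ
quadSeq α β γ n = ((α ℤ.* (+ n) ℤ.* (+ n) ℤ.+ β ℤ.* (+ n)) /ℕ 2) ℤ.+ γ

PairwiseIncongruent : (ℕ → ℤ) → ℕ → ℕ → Set
PairwiseIncongruent s n m =
  ∀ i j → i < n → j < n → i ≢ j → ¬ ((+ m) ∣ (s i - s j))

IsDiscriminator : (ℕ → ℤ) → ℕ → ℕ → Set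
IsDiscriminator s n m =
  1 ℕ.≤ m × PairwiseIncongruent s n m ×
  (∀ k → 1 ℕ.≤ k → k < m → ¬ PairwiseIncongruent s n k)

IsCeilLog : ℕ → ℕ → ℕ → Set
IsCeilLog p n k = n ≤ p ^ k × (∀ j → j < k → ¬ (n ≤ p ^ j))

{-# OPTIONS --safe #-}
module Submission where

open import Defs
open import Data.Nat using (ℕ; _≤_; _^_)
open import Data.Nat.Primality using (Prime)
open import Data.Integer using (ℤ; +_)
open import Data.Integer.Divisibility using (_∣_)
open import Data.Product using (Σ; _×_)
open import Relation.Nullary using (¬_)

open import Data.Nat as ℕ using (zero; suc; _<_; _∸_; z≤n; s≤s)
import Data.Nat.Properties as ℕₚ
import Data.Nat.Divisibility as ℕᵈ
import Data.Nat.Coprimality as ℕᶜ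
open import Data.Nat.GCD using (module Bézout)
open import Data.Nat.Primality using (prime⇒irreducible; prime⇒nonZero; euclidsLemma)
import Data.Nat.Tactic.RingSolver as ℕ-Solver
open import Data.Integer using (_+_; _*_; _-_; -_; ∣_∣; _⊖_; -[1+_]; 1ℤ; NonZero)
import Data.Integer.Properties as ℤₚ
import Data.Integer.Coprimality as ℤᶜ
open import Data.Integer.DivMod using (_/ℕ_; _%ℕ_; n%ℕd<d; a≡a%ℕn+[a/ℕn]*n)
open import Data.Integer.Divisibility.Signed as ℤˢ using (divides; ∣ᵤ⇒∣; ∣⇒∣ᵤ)
  renaming (_∣_ to _∣ˢ_)
open import Data.Integer.Tactic.RingSolver using (solve-∀)
open import Data.Product using (∃; _,_)
open import Data.Sum using (_⊎_; inj₁; inj₂)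
open import Function using (_∘_)
open import Relation.Binary.Definitions using (tri<; tri≈; tri>)
open import Relation.Binary.PropositionalEquality
open import Relation.Nullary using (Dec; contradiction; yes; no)

-- With Q the sequence, 2 (Q i - Q j) = (i - j) (α (i + j) + β).
--
-- If p ∤ α, or p divides both α and β, some r satisfies p ∣ α r + β, and two
-- distinct indices below p with i + j ≡ r (mod p) collide modulo p; so D_Q(p) ≠ p.
--
-- Otherwise p ∣ α and p ∤ β, so for indices i, j ≤ p^a a congruence modulo p^a
-- forces p^a ∣ i - j, i.e. {i, j} = {0, p^a}. Hence the modulus (p - 1) p^a < p^(a+1)
-- separates Q 0, …, Q (p^a) unless 2 (p - 1) ∣ α p^a + β. This cannot happen for
-- both a = 1 and a = 2: the difference α p (p - 1) would then make α p even.

m<n∧n∣m⇒m≡0 : ∀ {m n} → m < n → n ℕᵈ.∣ m → m ≡ 0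
m<n∧n∣m⇒m≡0 {zero}  _   _   = refl
m<n∧n∣m⇒m≡0 {suc _} m<n n∣m = contradiction n∣m (ℕᵈ.>⇒∤ m<n)

/ℕ-exact : ∀ m d .{{_ : ℕ.NonZero d}} → + d ∣ˢ m → m /ℕ d * + d ≡ m
/ℕ-exact m d d∣m = begin
  m /ℕ d * + d               ≡⟨ ℤₚ.+-identityˡ _ ⟨
  + 0 + m /ℕ d * + d         ≡⟨ cong (λ r → + r + m /ℕ d * + d) r≡0 ⟨
  + (m %ℕ d) + m /ℕ d * + d  ≡⟨ a≡a%ℕn+[a/ℕn]*n m d ⟨
  m                          ∎
  where
  open ≡-Reasoning
  d∣r : + d ∣ˢ + (m %ℕ d)
  d∣r = ℤˢ.∣m+n∣n⇒∣m (subst (+ d ∣ˢ_) (a≡a%ℕn+[a/ℕn]*n m d) d∣m)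
                     (ℤˢ.∣n⇒∣m*n (m /ℕ d) ℤˢ.∣-refl)
  r≡0 : m %ℕ d ≡ 0
  r≡0 = m<n∧n∣m⇒m≡0 (n%ℕd<d m d) (∣⇒∣ᵤ d∣r)

2∤i⇒i≡1+c*2 : ∀ i → ¬ (+ 2 ∣ i) → ∃ λ c → i ≡ + 1 + c * + 2
2∤i⇒i≡1+c*2 i 2∤i with i %ℕ 2 | n%ℕd<d i 2 | a≡a%ℕn+[a/ℕn]*n i 2
... | 0 | _ | i≡ = contradiction (∣⇒∣ᵤ (divides (i /ℕ 2) (trans i≡ (ℤₚ.+-identityˡ _)))) 2∤i
... | 1 | _ | i≡ = i /ℕ 2 , i≡
... | suc (suc _) | s≤s (s≤s ()) | _

2∤i∧2∤j⇒2∣j-i : ∀ i j → ¬ (+ 2 ∣ i) → ¬ (+ 2 ∣ j) → + 2 ∣ˢ j - i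
2∤i∧2∤j⇒2∣j-i i j 2∤i 2∤j with 2∤i⇒i≡1+c*2 i 2∤i | 2∤i⇒i≡1+c*2 j 2∤j
... | c , refl | d , refl = divides (d - c) (difference c d)
  where
  difference : ∀ c d → (+ 1 + d * + 2) - (+ 1 + c * + 2) ≡ (d - c) * + 2
  difference = solve-∀

2∣n*[1+n] : ∀ n → 2 ℕᵈ.∣ n ℕ.* suc n
2∣n*[1+n] zero    = ℕᵈ.divides 0 refl
2∣n*[1+n] (suc n) = subst (2 ℕᵈ.∣_) (step n) (ℕᵈ.∣m∣n⇒∣m+n (2∣n*[1+n] n) (ℕᵈ.m∣m*n (suc n)))
  where
  step : ∀ n → n ℕ.* suc n ℕ.+ 2 ℕ.* suc n ≡ suc n ℕ.* suc (suc n)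
  step = ℕ-Solver.solve-∀

prime∤⇒coprime : ∀ {p n} → Prime p → ¬ (p ℕᵈ.∣ n) → ℕᶜ.Coprime n p
prime∤⇒coprime pr p∤n (d∣n , d∣p) with prime⇒irreducible pr d∣p
... | inj₁ d≡1 = d≡1
... | inj₂ refl = contradiction d∣n p∤n

∣i∣*∣i∣≡i*i : ∀ i → + ∣ i ∣ * + ∣ i ∣ ≡ i * i
∣i∣*∣i∣≡i*i (+ n)    = refl
∣i∣*∣i∣≡i*i -[1+ n ] = refl

square-inverse : ∀ {d} α x → (+ d ∣ˢ + x * + ∣ α ∣ - 1ℤ) ⊎ (+ d ∣ˢ + x * + ∣ α ∣ + 1ℤ) →
  + d ∣ˢ α * (α * + x * + x) - 1ℤ
square-inverse {d} α x d∣X±1 = subst (+ d ∣ˢ_) product≡ (d∣product d∣X±1)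
  where
  open ≡-Reasoning
  X : ℤ
  X = + x * + ∣ α ∣
  d∣product : (+ d ∣ˢ X - 1ℤ) ⊎ (+ d ∣ˢ X + 1ℤ) → + d ∣ˢ (X - 1ℤ) * (X + 1ℤ)
  d∣product (inj₁ d∣X-1) = ℤˢ.∣m⇒∣m*n (X + 1ℤ) d∣X-1
  d∣product (inj₂ d∣X+1) = ℤˢ.∣n⇒∣m*n (X - 1ℤ) d∣X+1
  expand : ∀ x a → (x * a - 1ℤ) * (x * a + 1ℤ) ≡ x * x * (a * a) - 1ℤ
  expand = solve-∀
  regroup : ∀ x α → x * x * (α * α) - 1ℤ ≡ α * (α * x * x) - 1ℤ
  regroup = solve-∀
  product≡ : (X - 1ℤ) * (X + 1ℤ) ≡ α * (α * + x * + x) - 1ℤ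
  product≡ = begin
    (X - 1ℤ) * (X + 1ℤ)                      ≡⟨ expand (+ x) (+ ∣ α ∣) ⟩
    + x * + x * (+ ∣ α ∣ * + ∣ α ∣) - 1ℤ      ≡⟨ cong (λ a² → + x * + x * a² - 1ℤ) (∣i∣*∣i∣≡i*i α) ⟩
    + x * + x * (α * α) - 1ℤ                  ≡⟨ regroup (+ x) α ⟩
    α * (α * + x * + x) - 1ℤ                  ∎

-- Bézout inverts ∣ α ∣ modulo p only up to sign; its square inverts α * α = ∣ α ∣ * ∣ α ∣.
inverse-mod : ∀ {p} α → Prime p → ¬ (+ p ∣ α) → ∃ λ u → + p ∣ˢ α * u - 1ℤ
inverse-mod {p} α pr p∤α with ℕᶜ.coprime-Bézout (prime∤⇒coprime pr p∤α)
... | Bézout.+- x y eq = α * + x * + x , square-inverse α x (inj₁ (divides (+ y) (begin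
  + x * + ∣ α ∣ - 1ℤ          ≡⟨ cong (_- 1ℤ) (ℤₚ.pos-* x ∣ α ∣) ⟨
  + (x ℕ.* ∣ α ∣) - 1ℤ        ≡⟨ cong (λ n → + n - 1ℤ) eq ⟨
  + (1 ℕ.+ y ℕ.* p) - 1ℤ      ≡⟨ cong (_- 1ℤ) (ℤₚ.pos-+ 1 (y ℕ.* p)) ⟩
  + 1 + + (y ℕ.* p) - 1ℤ      ≡⟨ cancel (+ (y ℕ.* p)) ⟩
  + (y ℕ.* p)                 ≡⟨ ℤₚ.pos-* y p ⟩
  + y * + p                   ∎)))
  where
  open ≡-Reasoning
  cancel : ∀ z → + 1 + z - 1ℤ ≡ z
  cancel = solve-∀
... | Bézout.-+ x y eq = α * + x * + x , square-inverse α x (inj₂ (divides (+ y) (begin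
  + x * + ∣ α ∣ + 1ℤ          ≡⟨ ℤₚ.+-comm (+ x * + ∣ α ∣) 1ℤ ⟩
  + 1 + + x * + ∣ α ∣         ≡⟨ cong (λ z → + 1 + z) (ℤₚ.pos-* x ∣ α ∣) ⟨
  + (1 ℕ.+ x ℕ.* ∣ α ∣)       ≡⟨ cong +_ eq ⟩
  + (y ℕ.* p)                 ≡⟨ ℤₚ.pos-* y p ⟩
  + y * + p                   ∎)))
  where open ≡-Reasoning

root-shift : ∀ {d} α β x y → + d ∣ˢ α * x + β → + d ∣ˢ y - x → + d ∣ˢ α * y + β
root-shift α β x y d∣root d∣y-x =
  subst (_ ∣ˢ_) (shift α β x y) (ℤˢ.∣m∣n⇒∣m+n d∣root (ℤˢ.∣n⇒∣m*n α d∣y-x))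
  where
  shift : ∀ α β x y → α * x + β + α * (y - x) ≡ α * y + β
  shift = solve-∀

root-mod : ∀ {p} α β → Prime p → ¬ (+ p ∣ α) → ∃ λ r → r < p × + p ∣ˢ α * + r + β
root-mod {p} α β pr p∤α with inverse-mod α pr p∤α
... | u , p∣αu-1 = t %ℕ p , n%ℕd<d t p , root-shift α β t (+ (t %ℕ p)) p∣αt+β p∣r-t
  where
  instance
    p≢0 : ℕ.NonZero p
    p≢0 = prime⇒nonZero pr
  open ≡-Reasoning
  t : ℤ
  t = - (β * u)
  p∣αt+β : + p ∣ˢ α * t + β
  p∣αt+β = subst (+ p ∣ˢ_) (factor α β u) (ℤˢ.∣n⇒∣m*n (- β) p∣αu-1)
    where
    factor : ∀ α β u → - β * (α * u - 1ℤ) ≡ α * - (β * u) + β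
    factor = solve-∀
  p∣r-t : + p ∣ˢ + (t %ℕ p) - t
  p∣r-t = divides (- (t /ℕ p)) (begin
    + (t %ℕ p) - t                           ≡⟨ cong (λ z → + (t %ℕ p) - z) (a≡a%ℕn+[a/ℕn]*n t p) ⟩
    + (t %ℕ p) - (+ (t %ℕ p) + t /ℕ p * + p) ≡⟨ cancel (+ (t %ℕ p)) (t /ℕ p) (+ p) ⟩
    - (t /ℕ p) * + p                         ∎)
    where
    cancel : ∀ r w p → r - (r + w * p) ≡ - w * p
    cancel = solve-∀

p^n∣m*k⇒p^n∣k : ∀ {p m k} n → Prime p → ¬ (p ℕᵈ.∣ m) → p ^ n ℕᵈ.∣ m ℕ.* k → p ^ n ℕᵈ.∣ k
p^n∣m*k⇒p^n∣k {k = k} zero _ _ _ = ℕᵈ.1∣ k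
p^n∣m*k⇒p^n∣k {p} {m} (suc n) pr p∤m pⁿ⁺¹∣mk
  with euclidsLemma m _ pr (ℕᵈ.∣-trans (ℕᵈ.m∣m*n (p ^ n)) pⁿ⁺¹∣mk)
... | inj₁ p∣m = contradiction p∣m p∤m
... | inj₂ (ℕᵈ.divides c refl) =
  subst (p ^ suc n ℕᵈ.∣_) (ℕₚ.*-comm p c) (ℕᵈ.*-monoʳ-∣ p (p^n∣m*k⇒p^n∣k n pr p∤m pⁿ∣mc))
  where
  instance
    p≢0 : ℕ.NonZero p
    p≢0 = prime⇒nonZero pr
  rearrange : ∀ m c p → m ℕ.* (c ℕ.* p) ≡ p ℕ.* (m ℕ.* c)
  rearrange = ℕ-Solver.solve-∀
  pⁿ∣mc : p ^ n ℕᵈ.∣ m ℕ.* c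
  pⁿ∣mc = ℕᵈ.*-cancelˡ-∣ p (subst (p ^ suc n ℕᵈ.∣_) (rearrange m c p) pⁿ⁺¹∣mk)

endpoints-≤ : ∀ {N i j} → i ≤ j → j ≤ N → i ≢ j → N ℕᵈ.∣ j ∸ i → i ≡ 0 × j ≡ N
endpoints-≤ {N} {i} {j} i≤j j≤N i≢j N∣j∸i = i≡0 , j≡N
  where
  instance
    j∸i≢0 : ℕ.NonZero (j ∸ i)
    j∸i≢0 = ℕ.≢-nonZero (λ j∸i≡0 → i≢j (ℕₚ.≤-antisym i≤j (ℕₚ.m∸n≡0⇒m≤n j∸i≡0)))
  N≤j∸i : N ≤ j ∸ i
  N≤j∸i = ℕᵈ.∣⇒≤ N∣j∸i
  j≡N : j ≡ N
  j≡N = ℕₚ.≤-antisym j≤N (ℕₚ.≤-trans N≤j∸i (ℕₚ.m∸n≤m j i))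
  i≡0 : i ≡ 0
  i≡0 = ℕₚ.∸-cancelˡ-≡ i≤j z≤n (ℕₚ.≤-antisym (ℕₚ.m∸n≤m j i) (subst (_≤ j ∸ i) (sym j≡N) N≤j∸i))

endpoints : ∀ {N i j} → i ≤ N → j ≤ N → i ≢ j → N ℕᵈ.∣ ∣ i ⊖ j ∣ →
  (i ≡ 0 × j ≡ N) ⊎ (i ≡ N × j ≡ 0)
endpoints {N} {i} {j} i≤N j≤N i≢j N∣ with ℕₚ.≤-total i j
... | inj₁ i≤j = inj₁ (endpoints-≤ i≤j j≤N i≢j (subst (N ℕᵈ.∣_) (ℤₚ.∣⊖∣-≤ i≤j) N∣))
... | inj₂ j≤i with endpoints-≤ j≤i i≤N (i≢j ∘ sym)
                      (subst (N ℕᵈ.∣_) (trans (ℤₚ.∣m⊖n∣≡∣n⊖m∣ i j) (ℤₚ.∣⊖∣-≤ j≤i)) N∣)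
...   | j≡0 , i≡N = inj₂ (i≡N , j≡0)

2∣quadSeq-numerator : ∀ α β → + 2 ∣ˢ β - α → ∀ n → + 2 ∣ˢ α * + n * + n + β * + n
2∣quadSeq-numerator α β 2∣β-α n =
  subst (+ 2 ∣ˢ_) (sym (split α β (+ n)))
    (ℤˢ.∣m∣n⇒∣m+n (ℤˢ.∣n⇒∣m*n α 2∣n[1+n]) (ℤˢ.∣m⇒∣m*n (+ n) 2∣β-α))
  where
  split : ∀ α β x → α * x * x + β * x ≡ α * (x * (+ 1 + x)) + (β - α) * x
  split = solve-∀
  2∣n[1+n] : + 2 ∣ˢ + n * (+ 1 + + n)
  2∣n[1+n] = subst (+ 2 ∣ˢ_) (trans (ℤₚ.pos-* n (suc n)) (cong (+ n *_) (ℤₚ.pos-+ 1 n)))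
                   (∣ᵤ⇒∣ (2∣n*[1+n] n))

quadSeq-double : ∀ α β γ → + 2 ∣ˢ β - α → ∀ n →
  quadSeq α β γ n * + 2 ≡ α * + n * + n + β * + n + γ * + 2
quadSeq-double α β γ 2∣β-α n = begin
  (M /ℕ 2 + γ) * + 2      ≡⟨ ℤₚ.*-distribʳ-+ (+ 2) (M /ℕ 2) γ ⟩
  M /ℕ 2 * + 2 + γ * + 2  ≡⟨ cong (_+ γ * + 2) (/ℕ-exact M 2 (2∣quadSeq-numerator α β 2∣β-α n)) ⟩
  M + γ * + 2             ∎
  where
  open ≡-Reasoning
  M : ℤ
  M = α * + n * + n + β * + n

quadSeq-diff : ∀ α β γ → + 2 ∣ˢ β - α → ∀ i j →
  (quadSeq α β γ i - quadSeq α β γ j) * + 2 ≡ (+ i - + j) * (α * (+ i + + j) + β)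
quadSeq-diff α β γ 2∣β-α i j = begin
  (quadSeq α β γ i - quadSeq α β γ j) * + 2
    ≡⟨ distrib (quadSeq α β γ i) (quadSeq α β γ j) ⟩
  quadSeq α β γ i * + 2 - quadSeq α β γ j * + 2
    ≡⟨ cong₂ _-_ (quadSeq-double α β γ 2∣β-α i) (quadSeq-double α β γ 2∣β-α j) ⟩
  (α * + i * + i + β * + i + γ * + 2) - (α * + j * + j + β * + j + γ * + 2)
    ≡⟨ factor α β γ (+ i) (+ j) ⟩
  (+ i - + j) * (α * (+ i + + j) + β) ∎
  where
  open ≡-Reasoning
  distrib : ∀ x y → (x - y) * + 2 ≡ x * + 2 - y * + 2
  distrib = solve-∀
  factor : ∀ α β γ x y →
    (α * x * x + β * x + γ * + 2) - (α * y * y + β * y + γ * + 2) ≡ (x - y) * (α * (x + y) + β)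
  factor = solve-∀

quadSeq-congruent : ∀ α β γ {d} → + 2 ∣ˢ β - α → ℕᶜ.Coprime d 2 → ∀ {i j} →
  + d ∣ˢ α * (+ i + + j) + β → + d ∣ quadSeq α β γ i - quadSeq α β γ j
quadSeq-congruent α β γ {d} 2∣β-α d⊥2 {i} {j} d∣ =
  ℤᶜ.coprime-divisor (+ d) (+ 2) (quadSeq α β γ i - quadSeq α β γ j) d⊥2
    (∣⇒∣ᵤ (subst (+ d ∣ˢ_) doubled (ℤˢ.∣n⇒∣m*n (+ i - + j) d∣)))
  where
  doubled : (+ i - + j) * (α * (+ i + + j) + β) ≡ + 2 * (quadSeq α β γ i - quadSeq α β γ j)
  doubled = trans (sym (quadSeq-diff α β γ 2∣β-α i j)) (ℤₚ.*-comm _ (+ 2))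

ends-congruent : ∀ α β γ → + 2 ∣ˢ β - α → ∀ {c N} .{{_ : ℕ.NonZero N}} →
  + (c ℕ.* N) ∣ quadSeq α β γ N - quadSeq α β γ 0 → + 2 * + c ∣ˢ α * + N + β
ends-congruent α β γ 2∣β-α {c} {N} cN∣ =
  ℤˢ.*-cancelˡ-∣ (+ N) (subst₂ _∣ˢ_ modulus≡ doubled≡ (ℤˢ.*-monoˡ-∣ (+ 2) cN∣ˢ))
  where
  cN∣ˢ : + (c ℕ.* N) ∣ˢ quadSeq α β γ N - quadSeq α β γ 0
  cN∣ˢ = ∣ᵤ⇒∣ {+ (c ℕ.* N)} {quadSeq α β γ N - quadSeq α β γ 0} cN∣
  modulus≡ : + (c ℕ.* N) * + 2 ≡ + N * (+ 2 * + c)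
  modulus≡ = trans (cong (_* + 2) (ℤₚ.pos-* c N)) (reorder (+ c) (+ N))
    where
    reorder : ∀ c N → c * N * + 2 ≡ N * (+ 2 * c)
    reorder = solve-∀
  doubled≡ : (quadSeq α β γ N - quadSeq α β γ 0) * + 2 ≡ + N * (α * + N + β)
  doubled≡ = trans (quadSeq-diff α β γ 2∣β-α N 0) (simplify α β (+ N))
    where
    simplify : ∀ α β N → (N - + 0) * (α * (N + + 0) + β) ≡ N * (α * N + β)
    simplify = solve-∀

ends-parity : ∀ α β c .{{_ : NonZero c}} → + 2 * c ∣ˢ α * (1ℤ + c) + β →
  + 2 * c ∣ˢ α * ((1ℤ + c) * (1ℤ + c)) + β → + 2 ∣ˢ α * (1ℤ + c)
ends-parity α β c h₁ h₂ =
  ℤˢ.*-cancelʳ-∣ c (subst (+ 2 * c ∣ˢ_) (difference α β c) (ℤˢ.∣m∣n⇒∣m-n h₂ h₁))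
  where
  difference : ∀ α β c → α * ((1ℤ + c) * (1ℤ + c)) + β - (α * (1ℤ + c) + β) ≡ α * (1ℤ + c) * c
  difference = solve-∀

IsCeilLog-unique : ∀ {p n k k′} → IsCeilLog p n k → IsCeilLog p n k′ → k ≡ k′
IsCeilLog-unique {k = k} {k′} (n≤pᵏ , minimal) (n≤pᵏ′ , minimal′) with ℕₚ.<-cmp k k′
... | tri< k<k′ _ _ = contradiction n≤pᵏ (minimal′ k k<k′)
... | tri≈ _ k≡k′ _ = k≡k′
... | tri> _ _ k′<k = contradiction n≤pᵏ′ (minimal k′ k′<k)

IsCeilLog-suc : ∀ {p n a} .{{_ : ℕ.NonZero p}} → p ^ a < n → n ≤ p ^ suc a → IsCeilLog p n (suc a)
IsCeilLog-suc {p} pᵃ<n n≤pᵃ⁺¹ = n≤pᵃ⁺¹ , λ j j≤a n≤pʲ →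
  ℕₚ.<⇒≱ pᵃ<n (ℕₚ.≤-trans n≤pʲ (ℕₚ.^-monoʳ-≤ p (ℕ.s≤s⁻¹ j≤a)))

collision⇒¬IsDiscriminator : ∀ {s n m i j} → i < n → j < n → i ≢ j →
  + m ∣ s i - s j → ¬ IsDiscriminator s n m
collision⇒¬IsDiscriminator i<n j<n i≢j m∣ (_ , incongruent , _) = incongruent _ _ i<n j<n i≢j m∣

incongruent⇒¬IsDiscriminator : ∀ {s n m m′} → 1 ≤ m′ → m′ < m →
  PairwiseIncongruent s n m′ → ¬ IsDiscriminator s n m
incongruent⇒¬IsDiscriminator 1≤m′ m′<m incongruent (_ , _ , least) = least _ 1≤m′ m′<m incongruent

DiscriminatorNotCeilPow : ℕ → (ℕ → ℤ) → ℕ → Set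
DiscriminatorNotCeilPow p s n = ∀ k → IsCeilLog p n k → ¬ IsDiscriminator s n (p ^ k)

SomeDiscriminatorNotCeilPow : ℕ → (ℕ → ℤ) → Set
SomeDiscriminatorNotCeilPow p s = ∃ λ n → 1 ≤ n × DiscriminatorNotCeilPow p s n

discriminatorNotCeilPow-p : ∀ α β γ {p r} → ℕᶜ.Coprime p 2 → 2 < p → + 2 ∣ˢ β - α →
  r < p → + p ∣ˢ α * + r + β → DiscriminatorNotCeilPow p (quadSeq α β γ) p
discriminatorNotCeilPow-p α β γ {p@(suc q)} p⊥2 2<p 2∣β-α r<p p∣root k ceil
  = subst (λ k → ¬ IsDiscriminator (quadSeq α β γ) p (p ^ k)) (IsCeilLog-unique p-ceil ceil)
      (collision r<p p∣root)
  where
  p-ceil : IsCeilLog p p 1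
  p-ceil = IsCeilLog-suc (ℕₚ.<-trans (s≤s (s≤s z≤n)) 2<p) (ℕₚ.≤-reflexive (sym (ℕₚ.*-identityʳ p)))
  congruent-pair : ∀ {i j} → i < p → j < p → i ≢ j →
    + p ∣ˢ α * (+ i + + j) + β → ¬ IsDiscriminator (quadSeq α β γ) p (p ^ 1)
  congruent-pair {i} {j} i<p j<p i≢j p∣ =
    collision⇒¬IsDiscriminator {quadSeq α β γ} i<p j<p i≢j
    (subst (λ m → + m ∣ quadSeq α β γ i - quadSeq α β γ j) (sym (ℕₚ.*-identityʳ p))
      (quadSeq-congruent α β γ 2∣β-α p⊥2 p∣))
  collision : ∀ {r} → r < p → + p ∣ˢ α * + r + β → ¬ IsDiscriminator (quadSeq α β γ) p (p ^ 1)
  collision {zero} _ p∣β =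
    congruent-pair {1} {q} (s≤s (ℕₚ.≤-trans (s≤s z≤n) (ℕ.s≤s⁻¹ 2<p))) ℕₚ.≤-refl 1≢q
    (root-shift α β (+ 0) (+ p) p∣β (ℤˢ.∣-reflexive (sym (ℤₚ.+-identityʳ (+ p)))))
    where
    1≢q : 1 ≢ q
    1≢q refl = contradiction 2<p λ { (s≤s (s≤s ())) }
  collision {suc m} r<p p∣root = congruent-pair r<p (s≤s z≤n) (λ ())
    (subst (λ x → + p ∣ˢ α * x + β) (sym (ℤₚ.+-identityʳ (+ suc m))) p∣root)

module _ (α β γ : ℤ) {p} (p-prime : Prime p) (2<p : 2 < p) (2∣β-α : + 2 ∣ˢ β - α)
         (p∣α : + p ∣ˢ α) (p∤β : ¬ (+ p ∣ β)) where

  private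
    Q : ℕ → ℤ
    Q = quadSeq α β γ
    instance
      p≢0 : ℕ.NonZero p
      p≢0 = prime⇒nonZero p-prime
    1≤p∸1 : 1 ≤ p ∸ 1
    1≤p∸1 = ℕₚ.pred-mono-≤ (ℕₚ.<⇒≤ 2<p)

  pᵃ∣diff⇒pᵃ∣dist : ∀ a {i j} → + (p ^ a) ∣ Q i - Q j → p ^ a ℕᵈ.∣ ∣ i ⊖ j ∣
  pᵃ∣diff⇒pᵃ∣dist a {i} {j} pᵃ∣ =
    subst (p ^ a ℕᵈ.∣_) (cong ∣_∣ (ℤₚ.m-n≡m⊖n i j)) (p^n∣m*k⇒p^n∣k a p-prime p∤X pᵃ∣X*d)
    where
    X : ℤ
    X = α * (+ i + + j) + β
    p∤X : ¬ (p ℕᵈ.∣ ∣ X ∣)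
    p∤X p∣X = p∤β (∣⇒∣ᵤ (ℤˢ.∣m+n∣m⇒∣n (∣ᵤ⇒∣ p∣X) (ℤˢ.∣m⇒∣m*n (+ i + + j) p∣α)))
    pᵃ∣X*d : p ^ a ℕᵈ.∣ ∣ X ∣ ℕ.* ∣ + i - + j ∣
    pᵃ∣X*d = subst (p ^ a ℕᵈ.∣_) (trans (ℤₚ.abs-* (+ i - + j) X) (ℕₚ.*-comm ∣ + i - + j ∣ ∣ X ∣))
      (∣⇒∣ᵤ (subst (+ (p ^ a) ∣ˢ_) (quadSeq-diff α β γ 2∣β-α i j)
                   (ℤˢ.∣m⇒∣m*n (+ 2) (∣ᵤ⇒∣ {+ (p ^ a)} {Q i - Q j} pᵃ∣))))

  incongruent-unless-ends : ∀ a {m} → p ^ a ℕᵈ.∣ m → ¬ (+ m ∣ Q (p ^ a) - Q 0) →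
    PairwiseIncongruent Q (suc (p ^ a)) m
  incongruent-unless-ends a {m} pᵃ∣m ends-apart i j i<n j<n i≢j m∣ =
    ends-apart (collision-at-ends (endpoints (ℕ.s≤s⁻¹ i<n) (ℕ.s≤s⁻¹ j<n) i≢j
                                 (pᵃ∣diff⇒pᵃ∣dist a (ℕᵈ.∣-trans pᵃ∣m m∣))))
    where
    Congruent : ℕ → ℕ → Set
    Congruent u v = + m ∣ Q u - Q v
    collision-at-ends : (i ≡ 0 × j ≡ p ^ a) ⊎ (i ≡ p ^ a × j ≡ 0) → Congruent (p ^ a) 0
    collision-at-ends (inj₁ (i≡0 , j≡pᵃ)) =
      subst (m ℕᵈ.∣_) (ℤₚ.∣i-j∣≡∣j-i∣ (Q 0) (Q (p ^ a))) (subst₂ Congruent i≡0 j≡pᵃ m∣)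
    collision-at-ends (inj₂ (i≡pᵃ , j≡0)) = subst₂ Congruent i≡pᵃ j≡0 m∣

  discriminatorNotCeilPow-p^a+1 : ∀ a → ¬ (+ ((p ∸ 1) ℕ.* p ^ a) ∣ Q (p ^ a) - Q 0) →
    DiscriminatorNotCeilPow p Q (suc (p ^ a))
  discriminatorNotCeilPow-p^a+1 a ends-apart k ceil =
    subst (λ k → ¬ IsDiscriminator Q (suc (p ^ a)) (p ^ k)) (IsCeilLog-unique ceil-a+1 ceil)
      (incongruent⇒¬IsDiscriminator {Q} 1≤m m<pᵃ⁺¹
        (incongruent-unless-ends a (ℕᵈ.n∣m*n (p ∸ 1)) ends-apart))
    where
    instance
      pᵃ≢0 : ℕ.NonZero (p ^ a)
      pᵃ≢0 = ℕₚ.m^n≢0 p a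
    ceil-a+1 : IsCeilLog p (suc (p ^ a)) (suc a)
    ceil-a+1 = IsCeilLog-suc {p} {suc (p ^ a)} {a} ℕₚ.≤-refl
      (ℕₚ.^-monoʳ-< p (ℕₚ.<-trans (s≤s (s≤s z≤n)) 2<p) {a} ℕₚ.≤-refl)
    1≤m : 1 ≤ (p ∸ 1) ℕ.* p ^ a
    1≤m = ℕₚ.*-mono-≤ 1≤p∸1 (ℕₚ.m^n>0 p a)
    m<pᵃ⁺¹ : (p ∸ 1) ℕ.* p ^ a < p ^ suc a
    m<pᵃ⁺¹ = ℕₚ.*-monoˡ-< (p ^ a) (ℕₚ.∸-monoʳ-< (s≤s z≤n) (ℕ.>-nonZero⁻¹ p))

  discriminatorNotCeilPow-ends : ¬ (+ 2 ∣ α) → SomeDiscriminatorNotCeilPow p Q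
  discriminatorNotCeilPow-ends 2∤α with (p ∸ 1) ℕ.* p ^ 1 ℕᵈ.∣? ∣ Q (p ^ 1) - Q 0 ∣
  ... | no ends₁-apart = suc (p ^ 1) , s≤s z≤n , discriminatorNotCeilPow-p^a+1 1 ends₁-apart
  ... | yes ends₁ = suc (p ^ 2) , s≤s z≤n , discriminatorNotCeilPow-p^a+1 2 λ ends₂ →
          2∤αp (ends-parity α β c (congruent-at {1} p¹≡x ends₁) (congruent-at {2} p²≡x*x ends₂))
    where
    c : ℤ
    c = + (p ∸ 1)
    instance
      c≢0 : NonZero c
      c≢0 = ℕ.>-nonZero 1≤p∸1
    x≡p : 1ℤ + c ≡ + p
    x≡p = cong +_ (ℕₚ.m+[n∸m]≡n (ℕ.>-nonZero⁻¹ p))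
    p¹≡x : + (p ^ 1) ≡ 1ℤ + c
    p¹≡x = trans (cong +_ (ℕₚ.*-identityʳ p)) (sym x≡p)
    p²≡x*x : + (p ^ 2) ≡ (1ℤ + c) * (1ℤ + c)
    p²≡x*x = trans (cong (λ n → + (p ℕ.* n)) (ℕₚ.*-identityʳ p))
                   (trans (ℤₚ.pos-* p p) (sym (cong₂ _*_ x≡p x≡p)))
    congruent-at : ∀ {a x} → + (p ^ a) ≡ x → + ((p ∸ 1) ℕ.* p ^ a) ∣ Q (p ^ a) - Q 0 →
      + 2 * c ∣ˢ α * x + β
    congruent-at {a} pᵃ≡x ends = subst (λ x → + 2 * c ∣ˢ α * x + β) pᵃ≡x
      (ends-congruent α β γ 2∣β-α {p ∸ 1} {p ^ a} {{ℕₚ.m^n≢0 p a}} ends)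
    2∤αp : ¬ (+ 2 ∣ˢ α * (1ℤ + c))
    2∤αp 2∣αp = 2∤α (ℤᶜ.coprime-divisor (+ 2) (+ p) α (ℕᶜ.sym (ℕᶜ.prime⇒coprime p-prime 2<p))
      (∣⇒∣ᵤ (subst (+ 2 ∣ˢ_) (trans (cong (α *_) x≡p) (ℤₚ.*-comm α (+ p))) 2∣αp)))

quadSeq-discriminatorNotCeilPow : ∀ {p} → Prime p → 2 < p → ∀ α β γ →
  ¬ (+ 2 ∣ α) → ¬ (+ 2 ∣ β) → SomeDiscriminatorNotCeilPow p (quadSeq α β γ)
quadSeq-discriminatorNotCeilPow {p} p-prime 2<p α β γ 2∤α 2∤β =
  by-cases (p ℕᵈ.∣? ∣ α ∣) (p ℕᵈ.∣? ∣ β ∣)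
  where
  2∣β-α : + 2 ∣ˢ β - α
  2∣β-α = 2∤i∧2∤j⇒2∣j-i α β 2∤α 2∤β
  1≤p : 1 ≤ p
  1≤p = ℕₚ.<-trans (s≤s z≤n) (ℕₚ.<-trans (s≤s (s≤s z≤n)) 2<p)
  at-p : (∃ λ r → r < p × + p ∣ˢ α * + r + β) → SomeDiscriminatorNotCeilPow p (quadSeq α β γ)
  at-p (r , r<p , p∣root) = p , 1≤p ,
    discriminatorNotCeilPow-p α β γ {p} (ℕᶜ.prime⇒coprime p-prime 2<p) 2<p 2∣β-α r<p p∣root
  root-0 : α * + 0 + β ≡ β
  root-0 = trans (cong (_+ β) (ℤₚ.*-zeroʳ α)) (ℤₚ.+-identityˡ β)
  by-cases : Dec (+ p ∣ α) → Dec (+ p ∣ β) → SomeDiscriminatorNotCeilPow p (quadSeq α β γ)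
  by-cases (no p∤α)   _          = at-p (root-mod α β p-prime p∤α)
  by-cases (yes _)    (yes p∣β)  = at-p (0 , 1≤p , subst (+ p ∣ˢ_) (sym root-0) (∣ᵤ⇒∣ {+ p} {β} p∣β))
  by-cases (yes p∣α)  (no p∤β)   =
    discriminatorNotCeilPow-ends α β γ p-prime 2<p 2∣β-α (∣ᵤ⇒∣ {+ p} {α} p∣α) p∤β 2∤α

corollary18 : (p : ℕ) → Prime p → 5 ≤ p →
    (α′ β′ γ : ℤ) → ¬ ((+ 2) ∣ α′) → ¬ ((+ 2) ∣ β′) →
    Σ ℕ (λ n → 1 ≤ n ×
      (∀ k → IsCeilLog p n k →
        ¬ IsDiscriminator (quadSeq α′ β′ γ) n (p ^ k)))
corollary18 p p-prime 5≤p =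
  quadSeq-discriminatorNotCeilPow p-prime (ℕₚ.≤-trans (s≤s (s≤s (s≤s z≤n))) 5≤p)
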